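{- For all $\varepsilon>0$ there exist $\delta=\delta(\varepsilon)>0$ and $n_0=n_0(\delta)\in\mathbb{N}$ such that the following holds: if $t$ is a $3$-colouring template for $K_n$ with $n\ge n_0$ satisfying (i) $\mathrm{Ent}(t)\ge(\log_32-\delta)\binom n2$, and (ii) at most $\delta\binom n3$ triangles of $K_n$ are rainbow in some realisation of $t$, then there is a pair of colours $\{c_1,c_2\}\subseteq[3]$ such that $t(e)=\{c_1,c_2\}$ for all but at most $\varepsilon\binom n2$ edges $e$ of $K_n$. (Equivalently, the family of templates $\{1,2\}^{K_n},\{1,3\}^{K_n},\{2,3\}^{K_n}$, $n\in\mathbb{N}$, is a stability family for the property of $3$-colourings of complete graphs with no rainbow triangle.)
   Context: A $3$-colouring template for $K_n$ is $t:E(K_n)\to2^{[3]}\setminus\{\emptyset\}$; a realisation of $t$ is a colouring $c:E(K_n)\to[3]$ with $c(e)\in t(e)$ for all $e$; $\mathrm{Ent}(t)=\sum_e\log_3|t(e)|$. A triangle is rainbow in a colouring if its three edges receive three distinct colours. $\{c_1,c_2\}^{K_n}$ denotes the template assigning $\{c_1,c_2\}$ to every edge.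
   Formalization: The parameter ε ranges only over the positive rationals, and the witness δ is taken in the positive rationals. -}

module Defs where

open import Data.Nat using (ℕ; suc; _*_; _^_; _≤_; _<_)
open import Data.Nat.Combinatorics using (_C_)
open import Data.Fin using (Fin) renaming (_<_ to _<ᶠ_; _<?_ to _<ᶠ?_)
open import Data.Fin.Subset using (Subset; Nonempty; _∈_; ∣_∣; ⁅_⁆; _∪_)
open import Data.Nat.ListAction using (product)
open import Data.List using (List; map; filter; length; cartesianProduct; allFin)
open import Data.List.Relation.Unary.All using (All)
open import Data.List.Relation.Unary.Unique.Propositional using (Unique)
open import Data.Product using (_×_; _,_; ∃; proj₁; proj₂)
open import Relation.Binary.PropositionalEquality using (_≡_)
open import Relation.Nullary using (¬_)
open import Relation.Nullary.Decidable using (_×-dec_; ¬?)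
import Data.Vec.Properties as VecP
import Data.Bool.Properties as BoolP

-- Colours: [3] = Fin 3.  A set of colours is a Subset 3.
-- Edges of K_n on vertex set Fin n are encoded as ordered pairs (i , j) with i < j.
-- A 3-colouring template assigns to each edge a nonempty set of colours;
-- values of t i j for i ≮ j are irrelevant.
record Template (n : ℕ) : Set where
  field
    col      : Fin n → Fin n → Subset 3
    nonempty : ∀ i j → i <ᶠ j → Nonempty (col i j)
open Template public

edges : (n : ℕ) → List (Fin n × Fin n)
edges n = filter (λ p → proj₁ p <ᶠ? proj₂ p) (cartesianProduct (allFin n) (allFin n))

Realisation : ∀ {n} → Template n → Set
Realisation {n} t = ∃ λ (c : Fin n → Fin n → Fin 3) → ∀ i j → i <ᶠ j → c i j ∈ col t i j

Rainbow : ∀ {n} → (Fin n → Fin n → Fin 3) → Fin n → Fin n → Fin n → Set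
Rainbow c i j k = ¬ (c i j ≡ c j k) × ¬ (c i j ≡ c i k) × ¬ (c j k ≡ c i k)

RainbowInSomeRealisation : ∀ {n} → Template n → Fin n × Fin n × Fin n → Set
RainbowInSomeRealisation t (i , j , k) =
  i <ᶠ j × j <ᶠ k × ∃ λ (r : Realisation t) → Rainbow (proj₁ r) i j k

-- 3 ^ Ent(t) = ∏_e |t(e)|
expEnt : ∀ {n} → Template n → ℕ
expEnt {n} t = product (map (λ p → ∣ col t (proj₁ p) (proj₂ p) ∣) (edges n))

-- Condition (i) with δ = p / q:  Ent(t) ≥ (log₃2 − δ) (n choose 2),
-- written after exponentiating base 3 and raising to the q-th power:
--   (∏_e |t(e)|)^q · 3^(p·N) ≥ 2^(q·N),  N = n choose 2.
EntropyCond : ∀ {n} → Template n → ℕ → ℕ → Set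
EntropyCond {n} t p q = 2 ^ (q * (n C 2)) ≤ (expEnt t ^ q) * 3 ^ (p * (n C 2))

-- Condition (ii) with δ = p / q: at most δ·(n choose 3) triangles are rainbow in
-- some realisation, i.e. every duplicate-free list of such triangles has length ℓ
-- with ℓ·q ≤ p·(n choose 3).
FewRainbowCond : ∀ {n} → Template n → ℕ → ℕ → Set
FewRainbowCond {n} t p q =
  (L : List (Fin n × Fin n × Fin n)) → Unique L → All (RainbowInSomeRealisation t) L →
  length L * q ≤ p * (n C 3)

badEdges : ∀ {n} → Template n → Subset 3 → ℕ
badEdges {n} t S =
  length (filter (λ p → ¬? (VecP.≡-dec BoolP._≟_ (col t (proj₁ p) (proj₂ p)) S)) (edges n))

module Submission where

-- Measure a colour set S by φ(S) = |S| - 1 bits, so 3^Ent(t) ≤ 2^Φ, Φ = Σ_e φ(t(e)),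
-- and call a triangle perfect if its three colour sets are the same pair of colours.
-- A finite check shows that every triangle with colour sets X, Y, Z satisfies
--   φ(X) + φ(Y) + φ(Z) + [imperfect] ≤ 3 + 4 · [X, Y, Z have an SDR],
-- and an SDR makes the triangle rainbow in some realisation.  Summing over all
-- triangles (each edge lies in n - 2 of them) and inserting conditions (i) and (ii)
-- leaves at most (n choose 3)/(6b) imperfect triangles.  Charging each edge whose
-- colour set differs from that of a pair (v , u) to an imperfect triangle through v,
-- and averaging over the pairs, yields a pair whose colour set {c₁ , c₂} is carried
-- by all but ε (n choose 2) edges.

open import Defs
open import Level using (0ℓ)
open import Function using (_∘_)
open import Function.Bundles using (mk⇔)
open import Data.Bool using (Bool; true; false; not; _∧_)
import Data.Bool.Properties as BoolP
open import Data.Empty using (⊥; ⊥-elim)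
open import Data.Nat using (ℕ; zero; suc; _+_; _*_; _∸_; _^_; _≤_; _<_; z≤n; s≤s; s<s⁻¹; _≤?_; >-nonZero)
  renaming (_≟_ to _≟ℕ_)
open import Data.Nat.Properties hiding (_≟_; _<?_)
open import Data.Nat.Combinatorics using (_C_; nC1≡n; nCk+nC[k+1]≡[n+1]C[k+1])
open import Data.Nat.Tactic.RingSolver using (solve-∀)
open import Data.Nat.ListAction using (product) renaming (sum to sumˡ)
open import Data.Nat.ListAction.Properties using (sum-++)
open import Data.Fin using (Fin; zero; suc; _≟_) renaming (_<_ to _<ᶠ_; _<?_ to _<ᶠ?_)
import Data.Fin.Properties as FinP
open import Data.Fin.Subset using (Subset; ∣_∣; ⁅_⁆; _∪_; _∈_; Nonempty)
open import Data.Fin.Subset.Properties using (anySubset?; nonempty?; _∈?_)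
open import Data.List using (List; []; _∷_; _++_; map; filter; length; cartesianProduct; allFin; tabulate)
open import Data.List.Properties using (map-++; map-∘; map-cong; map-tabulate)
import Data.List.Relation.Unary.All as All
open import Data.List.Relation.Unary.All.Properties using (all-filter)
open import Data.List.Relation.Unary.Unique.Propositional using (Unique)
import Data.List.Relation.Unary.Unique.Propositional.Properties as Unique
open import Data.Product using (∃; _×_; _,_; proj₁; proj₂)
open import Data.Sum using (_⊎_; inj₁; inj₂)
open import Data.Vec using ([]; _∷_)
open import Data.Vec.Properties using (≡-dec)
open import Relation.Binary using (tri<; tri≈; tri>)
open import Relation.Binary.PropositionalEquality
open import Relation.Nullary using (Dec; yes; no; does; ¬_)
open import Relation.Nullary.Decidable
  using (_×-dec_; _→-dec_; ¬?; map′; decidable-stable; from-yes; does-⇔; dec-true; dec-false)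
open import Relation.Unary using (Pred; Decidable)
open import Algebra.Properties.Semiring.Sum +-*-semiring
  using (sum; sum-syntax; sum-cong-≗; ∑-distrib-+; ∑-comm; *-distribˡ-sum)

𝟙 : Bool → ℕ
𝟙 true = 1
𝟙 false = 0

𝟙-∧₃ : ∀ a b c → 𝟙 (a ∧ (b ∧ c)) * 1 ≡ 𝟙 a * 𝟙 b * 𝟙 c
𝟙-∧₃ true true true = refl
𝟙-∧₃ true true false = refl
𝟙-∧₃ true false c = refl
𝟙-∧₃ false b c = refl

Σ-mono : ∀ {n} {f g : Fin n → ℕ} → (∀ i → f i ≤ g i) → sum f ≤ sum g
Σ-mono {zero} _ = z≤n
Σ-mono {suc n} f≤g = +-mono-≤ (f≤g zero) (Σ-mono (f≤g ∘ suc))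

Σ-const : ∀ n c → ∑[ i < n ] c ≡ n * c
Σ-const zero c = refl
Σ-const (suc n) c = cong (c +_) (Σ-const n c)

Σ-+₃ : ∀ {n} (f g h : Fin n → ℕ) → ∑[ i < n ] (f i + g i + h i) ≡ sum f + sum g + sum h
Σ-+₃ f g h = trans (∑-distrib-+ (λ i → f i + g i) h) (cong (_+ sum h) (∑-distrib-+ f g))

Σ-*ˡ : ∀ {n} c (f : Fin n → ℕ) → ∑[ i < n ] (c * f i) ≡ c * sum f
Σ-*ˡ c f = sym (*-distribˡ-sum c f)

Σ₂ : ∀ n → (Fin n → Fin n → ℕ) → ℕ
Σ₂ n f = ∑[ i < n ] ∑[ j < n ] f i j

Σ₃ : ∀ n → (Fin n → Fin n → Fin n → ℕ) → ℕ
Σ₃ n f = ∑[ i < n ] Σ₂ n (f i)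

module _ {n : ℕ} where

  Σ₂-cong : {f g : Fin n → Fin n → ℕ} → (∀ i j → f i j ≡ g i j) → Σ₂ n f ≡ Σ₂ n g
  Σ₂-cong f≡g = sum-cong-≗ (λ i → sum-cong-≗ (f≡g i))

  Σ₃-cong : {f g : Fin n → Fin n → Fin n → ℕ} → (∀ i j k → f i j k ≡ g i j k) → Σ₃ n f ≡ Σ₃ n g
  Σ₃-cong f≡g = sum-cong-≗ (λ i → Σ₂-cong (f≡g i))

  Σ₂-mono : {f g : Fin n → Fin n → ℕ} → (∀ i j → f i j ≤ g i j) → Σ₂ n f ≤ Σ₂ n g
  Σ₂-mono f≤g = Σ-mono (λ i → Σ-mono (f≤g i))

  Σ₃-mono : {f g : Fin n → Fin n → Fin n → ℕ} → (∀ i j k → f i j k ≤ g i j k) → Σ₃ n f ≤ Σ₃ n g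
  Σ₃-mono f≤g = Σ-mono (λ i → Σ₂-mono (f≤g i))

  Σ₂-+ : (f g : Fin n → Fin n → ℕ) → Σ₂ n (λ i j → f i j + g i j) ≡ Σ₂ n f + Σ₂ n g
  Σ₂-+ f g = trans (sum-cong-≗ (λ i → ∑-distrib-+ (f i) (g i)))
                   (∑-distrib-+ (λ i → sum (f i)) (λ i → sum (g i)))

  Σ₃-+ : (f g : Fin n → Fin n → Fin n → ℕ) → Σ₃ n (λ i j k → f i j k + g i j k) ≡ Σ₃ n f + Σ₃ n g
  Σ₃-+ f g = trans (sum-cong-≗ (λ i → Σ₂-+ (f i) (g i)))
                   (∑-distrib-+ (λ i → Σ₂ n (f i)) (λ i → Σ₂ n (g i)))

  Σ₂-+₃ : (f g h : Fin n → Fin n → ℕ) →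
    Σ₂ n (λ i j → f i j + g i j + h i j) ≡ Σ₂ n f + Σ₂ n g + Σ₂ n h
  Σ₂-+₃ f g h = trans (Σ₂-+ (λ i j → f i j + g i j) h) (cong (_+ Σ₂ n h) (Σ₂-+ f g))

  Σ₃-+₃ : (f g h : Fin n → Fin n → Fin n → ℕ) →
    Σ₃ n (λ i j k → f i j k + g i j k + h i j k) ≡ Σ₃ n f + Σ₃ n g + Σ₃ n h
  Σ₃-+₃ f g h = trans (Σ₃-+ (λ i j k → f i j k + g i j k) h) (cong (_+ Σ₃ n h) (Σ₃-+ f g))

  Σ₂-*ˡ : ∀ c (f : Fin n → Fin n → ℕ) → Σ₂ n (λ i j → c * f i j) ≡ c * Σ₂ n f
  Σ₂-*ˡ c f = trans (sum-cong-≗ (λ i → Σ-*ˡ c (f i))) (Σ-*ˡ c (λ i → sum (f i)))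

  Σ₃-*ˡ : ∀ c (f : Fin n → Fin n → Fin n → ℕ) → Σ₃ n (λ i j k → c * f i j k) ≡ c * Σ₃ n f
  Σ₃-*ˡ c f = trans (sum-cong-≗ (λ i → Σ₂-*ˡ c (f i))) (Σ-*ˡ c (λ i → Σ₂ n (f i)))

  Σ₃-swap₁₂ : (f : Fin n → Fin n → Fin n → ℕ) → Σ₃ n f ≡ Σ₃ n (λ a b c → f b a c)
  Σ₃-swap₁₂ f = ∑-comm (λ a b → sum (f a b))

  Σ₃-swap₂₃ : (f : Fin n → Fin n → Fin n → ℕ) → Σ₃ n f ≡ Σ₃ n (λ a b c → f a c b)
  Σ₃-swap₂₃ f = sum-cong-≗ (λ a → ∑-comm (f a))

Σˡ : {A : Set} → List A → (A → ℕ) → ℕ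
Σˡ xs f = sumˡ (map f xs)

Σˡ-cong : {A : Set} (xs : List A) {f g : A → ℕ} → (∀ x → f x ≡ g x) → Σˡ xs f ≡ Σˡ xs g
Σˡ-cong xs f≗g = cong sumˡ (map-cong f≗g xs)

length-Σˡ : {A : Set} (xs : List A) → length xs ≡ Σˡ xs (λ _ → 1)
length-Σˡ [] = refl
length-Σˡ (x ∷ xs) = cong suc (length-Σˡ xs)

Σˡ-filter : {A : Set} {P : Pred A 0ℓ} (P? : Decidable P) (xs : List A) (f : A → ℕ) →
  Σˡ (filter P? xs) f ≡ Σˡ xs (λ x → 𝟙 (does (P? x)) * f x)
Σˡ-filter P? [] f = refl
Σˡ-filter P? (x ∷ xs) f with does (P? x)
... | true = cong₂ _+_ (sym (+-identityʳ (f x))) (Σˡ-filter P? xs f)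
... | false = Σˡ-filter P? xs f

Σˡ-cartesian : {A B : Set} (xs : List A) (ys : List B) (f : A × B → ℕ) →
  Σˡ (cartesianProduct xs ys) f ≡ Σˡ xs (λ x → Σˡ ys (λ y → f (x , y)))
Σˡ-cartesian [] ys f = refl
Σˡ-cartesian (x ∷ xs) ys f = begin
  sumˡ (map f (map (x ,_) ys ++ cartesianProduct xs ys))
    ≡⟨ cong sumˡ (map-++ f (map (x ,_) ys) _) ⟩
  sumˡ (map f (map (x ,_) ys) ++ map f (cartesianProduct xs ys))
    ≡⟨ sum-++ (map f (map (x ,_) ys)) _ ⟩
  Σˡ (map (x ,_) ys) f + Σˡ (cartesianProduct xs ys) f
    ≡⟨ cong₂ _+_ (cong sumˡ (sym (map-∘ ys))) (Σˡ-cartesian xs ys f) ⟩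
  Σˡ ys (λ y → f (x , y)) + Σˡ xs (λ x → Σˡ ys (λ y → f (x , y))) ∎
  where open ≡-Reasoning

Σˡ-allFin : ∀ n (f : Fin n → ℕ) → Σˡ (allFin n) f ≡ sum f
Σˡ-allFin n f = trans (cong sumˡ (map-tabulate (λ i → i) f)) (sum-tabulate n f)
  where
  sum-tabulate : ∀ n (g : Fin n → ℕ) → sumˡ (tabulate g) ≡ sum g
  sum-tabulate zero g = refl
  sum-tabulate (suc n) g = cong (g zero +_) (sum-tabulate n (g ∘ suc))

product≤2^Σ : {A : Set} (xs : List A) (f g : A → ℕ) → (∀ x → f x ≤ 2 ^ g x) →
  product (map f xs) ≤ 2 ^ Σˡ xs g
product≤2^Σ [] f g f≤ = ≤-refl
product≤2^Σ (x ∷ xs) f g f≤ =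
  ≤-trans (*-mono-≤ (f≤ x) (product≤2^Σ xs f g f≤)) (≤-reflexive (sym (^-distribˡ-+-* 2 (g x) _)))

ι : ∀ {n} → Fin n → Fin n → ℕ
ι i j = 𝟙 (does (i <ᶠ? j))

ι₃ : ∀ {n} → Fin n → Fin n → Fin n → ℕ
ι₃ i j k = ι i j * ι j k

ι-< : ∀ {n} {i j : Fin n} → i <ᶠ j → ι i j ≡ 1
ι-< {i = i} {j} i<j = cong 𝟙 (dec-true (i <ᶠ? j) i<j)

ι-≮ : ∀ {n} {i j : Fin n} → ¬ i <ᶠ j → ι i j ≡ 0
ι-≮ {i = i} {j} i≮j = cong 𝟙 (dec-false (i <ᶠ? j) i≮j)

ι-split : ∀ {n} (i j : Fin n) → i <ᶠ j ⊎ ι i j ≡ 0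
ι-split i j with i <ᶠ? j
... | yes i<j = inj₁ i<j
... | no i≮j = inj₂ (ι-≮ i≮j)

ι≤1 : ∀ {n} (i j : Fin n) → ι i j ≤ 1
ι≤1 i j with does (i <ᶠ? j)
... | true = ≤-refl
... | false = z≤n

ι₃≤1 : ∀ {n} (i j k : Fin n) → ι₃ i j k ≤ 1
ι₃≤1 i j k = *-mono-≤ (ι≤1 i j) (ι≤1 j k)

ι≡1⇒< : ∀ {n} {i j : Fin n} → ι i j ≡ 1 → i <ᶠ j
ι≡1⇒< {i = i} {j} ι≡1 with i <ᶠ? j
... | yes i<j = i<j
... | no i≮j = ⊥-elim (0≢1+n (trans (sym (ι-≮ i≮j)) ι≡1))

ι₃≡1⇒increasing : ∀ {n} {i j k : Fin n} → ι₃ i j k ≡ 1 → i <ᶠ j × j <ᶠ k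
ι₃≡1⇒increasing {i = i} {j} {k} ι₃≡1 =
  ι≡1⇒< (m*n≡1⇒m≡1 (ι i j) (ι j k) ι₃≡1) , ι≡1⇒< (m*n≡1⇒n≡1 (ι i j) (ι j k) ι₃≡1)

ι₃-transitive : ∀ {n} (i j k : Fin n) → ι₃ i j k ≡ ι i k * ι₃ i j k
ι₃-transitive i j k with i <ᶠ? j | j <ᶠ? k
... | yes i<j | yes j<k rewrite ι-< i<j | ι-< j<k | ι-< (FinP.<-trans i<j j<k) = refl
... | yes _ | no j≮k rewrite ι-≮ j≮k | *-zeroʳ (ι i j) = sym (*-zeroʳ (ι i k))
... | no i≮j | _ rewrite ι-≮ i≮j = sym (*-zeroʳ (ι i k))

Σ-zero : ∀ n → ∑[ i < n ] 0 ≡ 0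
Σ-zero n = trans (Σ-const n 0) (*-zeroʳ n)

pairs-count : ∀ n → Σ₂ n ι ≡ n C 2
pairs-count zero = refl
pairs-count (suc m) = begin
  ∑[ j < m ] 1 + Σ₂ m ι   ≡⟨ cong₂ _+_ (trans (Σ-const m 1) (*-identityʳ m)) (pairs-count m) ⟩
  m + m C 2               ≡⟨ cong (_+ m C 2) (sym (nC1≡n m)) ⟩
  m C 1 + m C 2           ≡⟨ nCk+nC[k+1]≡[n+1]C[k+1] m 1 ⟩
  suc m C 2               ∎
  where open ≡-Reasoning

triangles-count : ∀ n → Σ₃ n ι₃ ≡ n C 3
triangles-count zero = refl
triangles-count (suc m) = begin
  Σ₃ (suc m) ι₃       ≡⟨ cong₂ _+_ triples-from-0 triples-from-suc ⟩
  Σ₂ m ι + Σ₃ m ι₃    ≡⟨ cong₂ _+_ (pairs-count m) (triangles-count m) ⟩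
  m C 2 + m C 3       ≡⟨ nCk+nC[k+1]≡[n+1]C[k+1] m 2 ⟩
  suc m C 3           ∎
  where
  open ≡-Reasoning
  triples-from-0 : Σ₂ (suc m) (ι₃ zero) ≡ Σ₂ m ι
  triples-from-0 = cong₂ _+_ (Σ-zero (suc m)) (Σ₂-cong {m} (λ j k → +-identityʳ (ι j k)))
  triples-from-suc : ∑[ i < m ] Σ₂ (suc m) (ι₃ (suc i)) ≡ Σ₃ m ι₃
  triples-from-suc = sum-cong-≗ {m} (λ i → cong₂ _+_ (Σ-zero (suc m))
                       (sum-cong-≗ (λ j → cong (_+ sum (ι₃ i j)) (*-zeroʳ (ι i j)))))

-- For a < b, every vertex c other than a and b lies after b, before a,
-- or strictly between them; hence these positions account for n - 2 vertices.
outside : ∀ {n} → Fin n → Fin n → Fin n → ℕ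
outside a b c = ι b c + ι c a + ι a c * ι c b

neighbours-count : ∀ n (b : Fin n) → ∑[ c < n ] (ι b c + ι c b) + 1 ≡ n
neighbours-count (suc m) zero =
  trans (+-comm (∑[ c < m ] 1) 1) (cong suc (trans (Σ-const m 1) (*-identityʳ m)))
neighbours-count (suc m) (suc b) = cong suc (neighbours-count m b)

outside-count : ∀ n (a b : Fin n) → a <ᶠ b → sum (outside a b) + 2 ≡ n
outside-count (suc m) zero (suc b) _ = begin
  ∑[ c < m ] (ι b c + 0 + (ι c b + 0)) + 2
    ≡⟨ cong (_+ 2) (sum-cong-≗ (λ c → cong₂ _+_ (+-identityʳ (ι b c)) (+-identityʳ (ι c b)))) ⟩
  ∑[ c < m ] (ι b c + ι c b) + 2  ≡⟨ +-suc _ 1 ⟩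
  suc (∑[ c < m ] (ι b c + ι c b) + 1)  ≡⟨ cong suc (neighbours-count m b) ⟩
  suc m ∎
  where open ≡-Reasoning
outside-count (suc m) (suc a) (suc b) a<b = cong suc (outside-count m a b (s<s⁻¹ a<b))

outside-sum : ∀ {n} {a b : Fin n} → a <ᶠ b → sum (outside a b) ≡ n ∸ 2
outside-sum {n} {a} {b} a<b = begin
  sum (outside a b)           ≡⟨ sym (m+n∸n≡m (sum (outside a b)) 2) ⟩
  sum (outside a b) + 2 ∸ 2   ≡⟨ cong (_∸ 2) (outside-count n a b a<b) ⟩
  n ∸ 2                       ∎
  where open ≡-Reasoning

-- Double counting: summing over all triangles i < j < k the weights of their
-- three edges counts every edge a < b once for each of the n - 2 other vertices.
module _ {n : ℕ} (w : Fin n → Fin n → ℕ) where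

  private
    wₑ : Fin n → Fin n → ℕ
    wₑ a b = ι a b * w a b

    rearrange : ∀ x y z → x * y * z ≡ (x * z) * y
    rearrange = solve-∀

    as-first-edge : Σ₃ n (λ i j k → ι₃ i j k * w i j) ≡ Σ₂ n (λ a b → wₑ a b * ∑[ c < n ] ι b c)
    as-first-edge = Σ₂-cong (λ a b →
      trans (sum-cong-≗ (λ c → rearrange (ι a b) (ι b c) (w a b))) (Σ-*ˡ (wₑ a b) (ι b)))

    as-second-edge : Σ₃ n (λ i j k → ι₃ i j k * w j k) ≡ Σ₂ n (λ a b → wₑ a b * ∑[ c < n ] ι c a)
    as-second-edge = begin
      Σ₃ n (λ i j k → ι₃ i j k * w j k)          ≡⟨ Σ₃-swap₁₂ (λ i j k → ι₃ i j k * w j k) ⟩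
      Σ₃ n (λ a i c → ι₃ i a c * w a c)          ≡⟨ Σ₃-swap₂₃ (λ a i c → ι₃ i a c * w a c) ⟩
      Σ₃ n (λ a b c → ι c a * ι a b * w a b)     ≡⟨ Σ₂-cong (λ a b → trans
                                                      (sum-cong-≗ (λ c → reorder (ι c a) (ι a b) (w a b)))
                                                      (Σ-*ˡ (wₑ a b) (λ c → ι c a))) ⟩
      Σ₂ n (λ a b → wₑ a b * ∑[ c < n ] ι c a)   ∎
      where
      open ≡-Reasoning
      reorder : ∀ x y z → x * y * z ≡ (y * z) * x
      reorder = solve-∀

    as-long-edge : Σ₃ n (λ i j k → ι₃ i j k * w i k) ≡ Σ₂ n (λ a b → wₑ a b * ∑[ c < n ] ι₃ a c b)
    as-long-edge = begin
      Σ₃ n (λ i j k → ι₃ i j k * w i k)              ≡⟨ Σ₃-swap₂₃ (λ i j k → ι₃ i j k * w i k) ⟩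
      Σ₃ n (λ a b c → ι₃ a c b * w a b)              ≡⟨ Σ₃-cong (λ a b c → cong (_* w a b) (ι₃-transitive a c b)) ⟩
      Σ₃ n (λ a b c → ι a b * ι₃ a c b * w a b)      ≡⟨ Σ₂-cong (λ a b → trans
                                                          (sum-cong-≗ (λ c → rearrange (ι a b) (ι₃ a c b) (w a b)))
                                                          (Σ-*ˡ (wₑ a b) (λ c → ι₃ a c b))) ⟩
      Σ₂ n (λ a b → wₑ a b * ∑[ c < n ] ι₃ a c b)    ∎
      where open ≡-Reasoning

    third-vertices : ∀ a b → wₑ a b * sum (outside a b) ≡ (n ∸ 2) * wₑ a b
    third-vertices a b with ι-split a b
    ... | inj₁ a<b = trans (cong (wₑ a b *_) (outside-sum a<b)) (*-comm (wₑ a b) (n ∸ 2))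
    ... | inj₂ ι≡0 rewrite ι≡0 = sym (*-zeroʳ (n ∸ 2))

  triangle-edge-sum : Σ₃ n (λ i j k → ι₃ i j k * (w i j + w j k + w i k)) ≡
                      (n ∸ 2) * Σ₂ n (λ a b → ι a b * w a b)
  triangle-edge-sum = begin
    Σ₃ n (λ i j k → ι₃ i j k * (w i j + w j k + w i k))
      ≡⟨ Σ₃-cong (λ i j k → distrib (ι₃ i j k) (w i j) (w j k) (w i k)) ⟩
    Σ₃ n (λ i j k → ι₃ i j k * w i j + ι₃ i j k * w j k + ι₃ i j k * w i k)
      ≡⟨ Σ₃-+₃ (λ i j k → ι₃ i j k * w i j) (λ i j k → ι₃ i j k * w j k)
               (λ i j k → ι₃ i j k * w i k) ⟩
    Σ₃ n (λ i j k → ι₃ i j k * w i j) + Σ₃ n (λ i j k → ι₃ i j k * w j k)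
      + Σ₃ n (λ i j k → ι₃ i j k * w i k)
      ≡⟨ cong₂ _+_ (cong₂ _+_ as-first-edge as-second-edge) as-long-edge ⟩
    Σ₂ n (λ a b → wₑ a b * ∑[ c < n ] ι b c) + Σ₂ n (λ a b → wₑ a b * ∑[ c < n ] ι c a)
      + Σ₂ n (λ a b → wₑ a b * ∑[ c < n ] ι₃ a c b)
      ≡⟨ sym (Σ₂-+₃ (λ a b → wₑ a b * ∑[ c < n ] ι b c) (λ a b → wₑ a b * ∑[ c < n ] ι c a)
                     (λ a b → wₑ a b * ∑[ c < n ] ι₃ a c b)) ⟩
    Σ₂ n (λ a b → wₑ a b * ∑[ c < n ] ι b c + wₑ a b * ∑[ c < n ] ι c a + wₑ a b * ∑[ c < n ] ι₃ a c b)
      ≡⟨ Σ₂-cong (λ a b → trans (factor (wₑ a b) _ _ _)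
                          (trans (cong (wₑ a b *_) (sym (split a b))) (third-vertices a b))) ⟩
    Σ₂ n (λ a b → (n ∸ 2) * wₑ a b)
      ≡⟨ Σ₂-*ˡ (n ∸ 2) wₑ ⟩
    (n ∸ 2) * Σ₂ n wₑ ∎
    where
    open ≡-Reasoning
    distrib : ∀ x p q r → x * (p + q + r) ≡ x * p + x * q + x * r
    distrib = solve-∀
    factor : ∀ x p q r → x * p + x * q + x * r ≡ x * (p + q + r)
    factor = solve-∀
    split : ∀ a b → sum (outside a b) ≡ ∑[ c < n ] ι b c + ∑[ c < n ] ι c a + ∑[ c < n ] ι₃ a c b
    split a b = Σ-+₃ (ι b) (λ c → ι c a) (λ c → ι₃ a c b)

orderings : ∀ {n} → Fin n → Fin n → Fin n → ℕ
orderings a b c = ι₃ a b c + ι₃ a c b + ι₃ b a c + ι₃ b c a + ι₃ c a b + ι₃ c b a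

module _ {n : ℕ} (a b c : Fin n) where

  orderings-swap₁₂ : orderings b a c ≡ orderings a b c
  orderings-swap₁₂ = reorder (ι a b) (ι b a) (ι a c) (ι c a) (ι b c) (ι c b)
    where
    reorder : ∀ ab ba ac ca bc cb →
      ba * ac + bc * ca + ab * bc + ac * cb + cb * ba + ca * ab ≡
      ab * bc + ac * cb + ba * ac + bc * ca + ca * ab + cb * ba
    reorder = solve-∀

  orderings-swap₂₃ : orderings a c b ≡ orderings a b c
  orderings-swap₂₃ = reorder (ι a b) (ι b a) (ι a c) (ι c a) (ι b c) (ι c b)
    where
    reorder : ∀ ab ba ac ca bc cb →
      ac * cb + ab * bc + ca * ab + cb * ba + ba * ac + bc * ca ≡
      ab * bc + ac * cb + ba * ac + bc * ca + ca * ab + cb * ba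
    reorder = solve-∀

  orderings-increasing : a <ᶠ b → b <ᶠ c → orderings a b c ≡ 1
  orderings-increasing a<b b<c
    rewrite ι-< a<b | ι-< b<c | ι-< (FinP.<-trans a<b b<c)
          | ι-≮ (FinP.<-asym a<b) | ι-≮ (FinP.<-asym b<c) | ι-≮ (FinP.<-asym (FinP.<-trans a<b b<c)) = refl

  outside≤orderings : a <ᶠ b → outside a b c ≤ orderings a b c
  outside≤orderings a<b rewrite ι-< a<b =
    ≤-trans (m≤m+n _ (ι b a * ι a c + ι b c * ι c a + ι c b * ι b a))
            (≤-reflexive (regroup (ι b a) (ι a c) (ι c a) (ι b c) (ι c b)))
    where
    regroup : ∀ ba ac ca bc cb → bc + ca + ac * cb + (ba * ac + bc * ca + cb * ba) ≡
                                 1 * bc + ac * cb + ba * ac + bc * ca + ca * 1 + cb * ba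
    regroup = solve-∀

orderings-distinct : ∀ {n} (a b c : Fin n) → a ≢ b → b ≢ c → a ≢ c → orderings a b c ≡ 1
orderings-distinct a b c a≢b b≢c a≢c with FinP.<-cmp a b | FinP.<-cmp b c | FinP.<-cmp a c
... | tri≈ _ a≡b _ | _ | _ = ⊥-elim (a≢b a≡b)
... | _ | tri≈ _ b≡c _ | _ = ⊥-elim (b≢c b≡c)
... | _ | _ | tri≈ _ a≡c _ = ⊥-elim (a≢c a≡c)
... | tri< a<b _ _ | tri< b<c _ _ | _ = orderings-increasing a b c a<b b<c
... | tri< a<b _ _ | tri> _ _ c<b | tri< a<c _ _ =
  trans (sym (orderings-swap₂₃ a b c)) (orderings-increasing a c b a<c c<b)
... | tri< a<b _ _ | tri> _ _ c<b | tri> _ _ c<a =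
  trans (sym (orderings-swap₂₃ a b c)) (trans (orderings-swap₁₂ c a b) (orderings-increasing c a b c<a a<b))
... | tri> _ _ b<a | tri< b<c _ _ | tri< a<c _ _ =
  trans (sym (orderings-swap₁₂ a b c)) (orderings-increasing b a c b<a a<c)
... | tri> _ _ b<a | tri< b<c _ _ | tri> _ _ c<a =
  trans (sym (orderings-swap₁₂ a b c)) (trans (orderings-swap₂₃ b c a) (orderings-increasing b c a b<c c<a))
... | tri> _ _ b<a | tri> _ _ c<b | _ =
  trans (sym (orderings-swap₁₂ a b c))
        (trans (orderings-swap₂₃ b c a) (trans (orderings-swap₁₂ c b a) (orderings-increasing c b a c<b b<a)))

-- Summing a permutation-invariant f against orderings counts every increasing
-- triple once for each of its six orders.
module _ {n : ℕ} (f : Fin n → Fin n → Fin n → ℕ)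
         (f-swap₁₂ : ∀ a b c → f b a c ≡ f a b c) (f-swap₂₃ : ∀ a b c → f a c b ≡ f a b c) where

  private
    F : Fin n → Fin n → Fin n → ℕ
    F a b c = ι₃ a b c * f a b c

    order-acb : Σ₃ n (λ a b c → ι₃ a c b * f a b c) ≡ Σ₃ n F
    order-acb = trans (Σ₃-swap₂₃ (λ a b c → ι₃ a c b * f a b c))
                      (Σ₃-cong (λ a b c → cong (ι₃ a b c *_) (f-swap₂₃ a b c)))

    order-bac : Σ₃ n (λ a b c → ι₃ b a c * f a b c) ≡ Σ₃ n F
    order-bac = trans (Σ₃-swap₁₂ (λ a b c → ι₃ b a c * f a b c))
                      (Σ₃-cong (λ a b c → cong (ι₃ a b c *_) (f-swap₁₂ a b c)))

    order-bca : Σ₃ n (λ a b c → ι₃ b c a * f a b c) ≡ Σ₃ n F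
    order-bca = trans (Σ₃-swap₁₂ (λ a b c → ι₃ b c a * f a b c))
                (trans (Σ₃-swap₂₃ (λ a b c → ι₃ a c b * f b a c))
                       (Σ₃-cong (λ a b c → cong (ι₃ a b c *_) (trans (f-swap₁₂ a c b) (f-swap₂₃ a b c)))))

    order-cab : Σ₃ n (λ a b c → ι₃ c a b * f a b c) ≡ Σ₃ n F
    order-cab = trans (Σ₃-swap₂₃ (λ a b c → ι₃ c a b * f a b c))
                (trans (Σ₃-swap₁₂ (λ a b c → ι₃ b a c * f a c b))
                       (Σ₃-cong (λ a b c → cong (ι₃ a b c *_) (trans (f-swap₂₃ b a c) (f-swap₁₂ a b c)))))

    order-cba : Σ₃ n (λ a b c → ι₃ c b a * f a b c) ≡ Σ₃ n F
    order-cba = trans (Σ₃-swap₁₂ (λ a b c → ι₃ c b a * f a b c))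
                (trans (Σ₃-swap₂₃ (λ a b c → ι₃ c a b * f b a c))
                (trans (Σ₃-swap₁₂ (λ a b c → ι₃ b a c * f c a b))
                       (Σ₃-cong (λ a b c → cong (ι₃ a b c *_)
                         (trans (f-swap₁₂ b c a) (trans (f-swap₂₃ b a c) (f-swap₁₂ a b c)))))))

  symmetrise : Σ₃ n (λ a b c → orderings a b c * f a b c) ≡ 6 * Σ₃ n (λ a b c → ι₃ a b c * f a b c)
  symmetrise = begin
    Σ₃ n (λ a b c → orderings a b c * f a b c)
      ≡⟨ Σ₃-cong (λ a b c → distrib (ι₃ a b c) (ι₃ a c b) (ι₃ b a c) (ι₃ b c a) (ι₃ c a b) (ι₃ c b a)
                                    (f a b c)) ⟩
    Σ₃ n (λ a b c → (F a b c + ι₃ a c b * f a b c + ι₃ b a c * f a b c)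
                  + (ι₃ b c a * f a b c + ι₃ c a b * f a b c + ι₃ c b a * f a b c))
      ≡⟨ Σ₃-+ (λ a b c → F a b c + ι₃ a c b * f a b c + ι₃ b a c * f a b c)
              (λ a b c → ι₃ b c a * f a b c + ι₃ c a b * f a b c + ι₃ c b a * f a b c) ⟩
    Σ₃ n (λ a b c → F a b c + ι₃ a c b * f a b c + ι₃ b a c * f a b c)
      + Σ₃ n (λ a b c → ι₃ b c a * f a b c + ι₃ c a b * f a b c + ι₃ c b a * f a b c)
      ≡⟨ cong₂ _+_ (Σ₃-+₃ F (λ a b c → ι₃ a c b * f a b c) (λ a b c → ι₃ b a c * f a b c))
                   (Σ₃-+₃ (λ a b c → ι₃ b c a * f a b c) (λ a b c → ι₃ c a b * f a b c)
                          (λ a b c → ι₃ c b a * f a b c)) ⟩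
    (Σ₃ n F + Σ₃ n (λ a b c → ι₃ a c b * f a b c) + Σ₃ n (λ a b c → ι₃ b a c * f a b c))
      + (Σ₃ n (λ a b c → ι₃ b c a * f a b c) + Σ₃ n (λ a b c → ι₃ c a b * f a b c)
         + Σ₃ n (λ a b c → ι₃ c b a * f a b c))
      ≡⟨ cong₂ _+_ (cong₂ _+_ (cong (Σ₃ n F +_) order-acb) order-bac)
                   (cong₂ _+_ (cong₂ _+_ order-bca order-cab) order-cba) ⟩
    (Σ₃ n F + Σ₃ n F + Σ₃ n F) + (Σ₃ n F + Σ₃ n F + Σ₃ n F)
      ≡⟨ six (Σ₃ n F) ⟩
    6 * Σ₃ n F ∎
    where
    open ≡-Reasoning
    distrib : ∀ x₁ x₂ x₃ x₄ x₅ x₆ y → (x₁ + x₂ + x₃ + x₄ + x₅ + x₆) * y ≡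
                                      (x₁ * y + x₂ * y + x₃ * y) + (x₄ * y + x₅ * y + x₆ * y)
    distrib = solve-∀
    six : ∀ y → (y + y + y) + (y + y + y) ≡ 6 * y
    six = solve-∀

three-triangles : ∀ n → 3 * (n C 3) ≡ (n ∸ 2) * (n C 2)
three-triangles n = begin
  3 * (n C 3)                                    ≡⟨ cong (3 *_) (sym (triangles-count n)) ⟩
  3 * Σ₃ n ι₃                                    ≡⟨ sym (Σ₃-*ˡ {n} 3 ι₃) ⟩
  Σ₃ n (λ i j k → 3 * ι₃ i j k)                  ≡⟨ Σ₃-cong {n} (λ i j k → *-comm 3 (ι₃ i j k)) ⟩
  Σ₃ n (λ i j k → ι₃ i j k * (1 + 1 + 1))        ≡⟨ triangle-edge-sum {n} (λ _ _ → 1) ⟩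
  (n ∸ 2) * Σ₂ n (λ a b → ι a b * 1)             ≡⟨ cong ((n ∸ 2) *_) (Σ₂-cong {n} (λ a b → *-identityʳ (ι a b))) ⟩
  (n ∸ 2) * Σ₂ n ι                               ≡⟨ cong ((n ∸ 2) *_) (pairs-count n) ⟩
  (n ∸ 2) * (n C 2)                              ∎
  where open ≡-Reasoning

averaging : ∀ {n} (g : Fin n → Fin n → ℕ) K → (∀ v u → v ≢ u → K < g v u) →
  2 * (n C 2) * suc K ≤ Σ₂ n g
averaging {n} g K K<g = begin
  2 * (n C 2) * suc K                              ≡⟨ cong (λ N → 2 * N * suc K) (sym (pairs-count n)) ⟩
  2 * Σ₂ n ι * suc K                               ≡⟨ cong (λ P → (Σ₂ n ι + P) * suc K) (+-identityʳ (Σ₂ n ι)) ⟩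
  (Σ₂ n ι + Σ₂ n ι) * suc K                        ≡⟨ cong (λ P → (Σ₂ n ι + P) * suc K) (∑-comm {n} {n} ι) ⟩
  (Σ₂ n ι + Σ₂ n (λ v u → ι u v)) * suc K          ≡⟨ cong (_* suc K) (sym (Σ₂-+ {n} ι (λ v u → ι u v))) ⟩
  Σ₂ n (λ v u → ι v u + ι u v) * suc K             ≡⟨ *-comm _ (suc K) ⟩
  suc K * Σ₂ n (λ v u → ι v u + ι u v)             ≡⟨ sym (Σ₂-*ˡ {n} (suc K) (λ v u → ι v u + ι u v)) ⟩
  Σ₂ n (λ v u → suc K * (ι v u + ι u v))           ≤⟨ Σ₂-mono pair ⟩
  Σ₂ n g                                           ∎
  where
  open ≤-Reasoning
  pair : ∀ v u → suc K * (ι v u + ι u v) ≤ g v u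
  pair v u with FinP.<-cmp v u
  ... | tri< v<u _ u≮v rewrite ι-< v<u | ι-≮ u≮v =
    ≤-trans (≤-reflexive (*-identityʳ (suc K))) (K<g v u (FinP.<⇒≢ v<u))
  ... | tri≈ v≮v refl _ rewrite ι-≮ v≮v = ≤-trans (≤-reflexive (*-zeroʳ (suc K))) z≤n
  ... | tri> v≮u _ u<v rewrite ι-< u<v | ι-≮ v≮u =
    ≤-trans (≤-reflexive (*-identityʳ (suc K))) (K<g v u (λ v≡u → FinP.<⇒≢ u<v (sym v≡u)))

-- Twice the number of pairs: 2 (n choose 2) = n (n - 1), stated without subtraction.
pairs-twice : ∀ n → (n C 2) * 2 + n ≡ n * n
pairs-twice zero = refl
pairs-twice (suc m) = begin
  (suc m C 2) * 2 + suc m        ≡⟨ cong (λ x → x * 2 + suc m) (sym (nCk+nC[k+1]≡[n+1]C[k+1] m 1)) ⟩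
  (m C 1 + m C 2) * 2 + suc m    ≡⟨ cong (λ x → (x + m C 2) * 2 + suc m) (nC1≡n m) ⟩
  (m + m C 2) * 2 + suc m        ≡⟨ regroup m (m C 2) ⟩
  ((m C 2) * 2 + m) + (2 * m + 1) ≡⟨ cong (_+ (2 * m + 1)) (pairs-twice m) ⟩
  m * m + (2 * m + 1)            ≡⟨ square m ⟩
  suc m * suc m                  ∎
  where
  open ≡-Reasoning
  regroup : ∀ m P → (m + P) * 2 + suc m ≡ (P * 2 + m) + (2 * m + 1)
  regroup = solve-∀
  square : ∀ m → m * m + (2 * m + 1) ≡ suc m * suc m
  square = solve-∀

n[n∸2]≤2[nC2] : ∀ n → n * (n ∸ 2) ≤ 2 * (n C 2)
n[n∸2]≤2[nC2] zero = z≤n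
n[n∸2]≤2[nC2] (suc zero) = z≤n
n[n∸2]≤2[nC2] (suc (suc k)) = begin
  n * k                  ≤⟨ m≤m+n (n * k) n ⟩
  n * k + n              ≡⟨ +-cancelʳ-≡ n (n * k + n) ((n C 2) * 2) (trans (expand k) (sym (pairs-twice n))) ⟩
  (n C 2) * 2            ≡⟨ *-comm (n C 2) 2 ⟩
  2 * (n C 2)            ∎
  where
  open ≤-Reasoning
  n : ℕ
  n = suc (suc k)
  expand : ∀ k → (2 + k) * k + (2 + k) + (2 + k) ≡ (2 + k) * (2 + k)
  expand = solve-∀

pairs-positive : ∀ n → 2 ≤ n → 1 ≤ n C 2
pairs-positive (suc zero) (s≤s ())
pairs-positive (suc (suc k)) _ = begin
  1                          ≤⟨ s≤s z≤n ⟩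
  suc k                      ≡⟨ sym (nC1≡n (suc k)) ⟩
  suc k C 1                  ≤⟨ m≤m+n (suc k C 1) (suc k C 2) ⟩
  suc k C 1 + suc k C 2      ≡⟨ nCk+nC[k+1]≡[n+1]C[k+1] (suc k) 1 ⟩
  suc (suc k) C 2            ∎
  where open ≤-Reasoning

∀Subset? : ∀ {n} {P : Pred (Subset n) 0ℓ} → Decidable P → Dec (∀ S → P S)
∀Subset? P? = map′ (λ none S → decidable-stable (P? S) (λ ¬PS → none (S , ¬PS)))
                   (λ all (S , ¬PS) → ¬PS (all S))
                   (¬? (anySubset? (¬? ∘ P?)))

𝟙-fails : {P : Set} → Dec P → ℕ
𝟙-fails p = 𝟙 (not (does p))

𝟙-fails-0 : {P : Set} (p : Dec P) → 𝟙-fails p ≡ 0 → P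
𝟙-fails-0 (yes p) _ = p
𝟙-fails-0 (no _) ()

𝟙-fails-1 : {P : Set} (p : Dec P) → ¬ P → 𝟙-fails p ≡ 1
𝟙-fails-1 p ¬P = cong (𝟙 ∘ not) (dec-false p ¬P)

𝟙-fails-⇔ : {P Q : Set} → (P → Q) → (Q → P) → (p : Dec P) (q : Dec Q) → 𝟙-fails p ≡ 𝟙-fails q
𝟙-fails-⇔ P→Q Q→P p q = cong (𝟙 ∘ not) (does-⇔ (mk⇔ P→Q Q→P) p q)

Colours : Set
Colours = Subset 3

_≟ᶜ_ : (X Y : Colours) → Dec (X ≡ Y)
_≟ᶜ_ = ≡-dec BoolP._≟_

-- φ S = |S| - 1 measures the entropy of a colour set in bits: |S| ≤ 2 ^ φ S.
φ : Colours → ℕ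
φ S = ∣ S ∣ ∸ 1

size≤2^φ : (S : Colours) → ∣ S ∣ ≤ 2 ^ φ S
size≤2^φ = from-yes (∀Subset? {3} λ S → ∣ S ∣ ≤? 2 ^ φ S)

-- A triangle with colour sets X, Y, Z is perfect if they are one and the same
-- pair of colours; this is the local picture of the extremal templates {c₁,c₂}^{K_n}.
Perfect : Colours → Colours → Colours → Set
Perfect X Y Z = X ≡ Y × Y ≡ Z × ∣ X ∣ ≡ 2

perfect? : ∀ X Y Z → Dec (Perfect X Y Z)
perfect? X Y Z = X ≟ᶜ Y ×-dec Y ≟ᶜ Z ×-dec ∣ X ∣ ≟ℕ 2

imperfect : Colours → Colours → Colours → ℕ
imperfect X Y Z = 𝟙-fails (perfect? X Y Z)

imperfect-swap₂₃ : ∀ X Y Z → imperfect X Z Y ≡ imperfect X Y Z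
imperfect-swap₂₃ X Y Z = 𝟙-fails-⇔ swap swap (perfect? X Z Y) (perfect? X Y Z)
  where
  swap : ∀ {X Y Z} → Perfect X Y Z → Perfect X Z Y
  swap (X≡Y , Y≡Z , ∣X∣≡2) = trans X≡Y Y≡Z , sym Y≡Z , ∣X∣≡2

imperfect-reverse : ∀ X Y Z → imperfect Z Y X ≡ imperfect X Y Z
imperfect-reverse X Y Z = 𝟙-fails-⇔ reverse reverse (perfect? Z Y X) (perfect? X Y Z)
  where
  reverse : ∀ {X Y Z} → Perfect X Y Z → Perfect Z Y X
  reverse (refl , refl , ∣X∣≡2) = refl , refl , ∣X∣≡2

-- A system of distinct representatives of X, Y, Z: three distinct colours,
-- one from each set.  This is what makes a triangle rainbow in some realisation.
SDR : Colours → Colours → Colours → Set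
SDR X Y Z = ∃ λ x → ∃ λ y → ∃ λ z → (x ∈ X × y ∈ Y × z ∈ Z) × (x ≢ y × y ≢ z × x ≢ z)

sdr? : ∀ X Y Z → Dec (SDR X Y Z)
sdr? X Y Z = FinP.any? λ x → FinP.any? λ y → FinP.any? λ z →
  (x ∈? X ×-dec y ∈? Y ×-dec z ∈? Z) ×-dec (¬? (x ≟ y) ×-dec ¬? (y ≟ z) ×-dec ¬? (x ≟ z))

-- The local inequality (checked over all 8³ triples of colour sets): a triangle
-- with nonempty colour sets and no SDR has total entropy at most 3 bits, and
-- at most 2 bits unless it is perfect; with an SDR the bound 7 is trivial.
LocalBound : Colours → Colours → Colours → Set
LocalBound X Y Z = Nonempty X → Nonempty Y → Nonempty Z →
  φ X + φ Y + φ Z + imperfect X Y Z ≤ 3 + 4 * 𝟙 (does (sdr? X Y Z))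

local-bound : (X Y Z : Colours) → LocalBound X Y Z
local-bound = from-yes (∀Subset? {3} λ X → ∀Subset? {3} λ Y → ∀Subset? {3} λ Z →
  nonempty? X →-dec nonempty? Y →-dec nonempty? Z →-dec
  φ X + φ Y + φ Z + imperfect X Y Z ≤? 3 + 4 * 𝟙 (does (sdr? X Y Z)))

size-two : (X : Colours) → ∣ X ∣ ≡ 2 → ∃ λ c₁ → ∃ λ c₂ → c₁ ≢ c₂ × X ≡ ⁅ c₁ ⁆ ∪ ⁅ c₂ ⁆
size-two (false ∷ true ∷ true ∷ []) _ = suc zero , suc (suc zero) , (λ ()) , refl
size-two (true ∷ false ∷ true ∷ []) _ = zero , suc (suc zero) , (λ ()) , refl
size-two (true ∷ true ∷ false ∷ []) _ = zero , suc zero , (λ ()) , refl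
size-two (false ∷ false ∷ false ∷ []) ()
size-two (false ∷ false ∷ true ∷ []) ()
size-two (false ∷ true ∷ false ∷ []) ()
size-two (true ∷ false ∷ false ∷ []) ()
size-two (true ∷ true ∷ true ∷ []) ()

Σ-edges : ∀ n (f : Fin n → Fin n → ℕ) →
  Σˡ (edges n) (λ e → f (proj₁ e) (proj₂ e)) ≡ Σ₂ n (λ a b → ι a b * f a b)
Σ-edges n f = begin
  Σˡ (edges n) (λ e → f (proj₁ e) (proj₂ e))
    ≡⟨ Σˡ-filter (λ e → proj₁ e <ᶠ? proj₂ e) (cartesianProduct (allFin n) (allFin n)) _ ⟩
  Σˡ (cartesianProduct (allFin n) (allFin n)) (λ e → ι (proj₁ e) (proj₂ e) * f (proj₁ e) (proj₂ e))
    ≡⟨ Σˡ-cartesian (allFin n) (allFin n) _ ⟩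
  Σˡ (allFin n) (λ a → Σˡ (allFin n) (λ b → ι a b * f a b))
    ≡⟨ trans (Σˡ-allFin n _) (sum-cong-≗ (λ a → Σˡ-allFin n (λ b → ι a b * f a b))) ⟩
  Σ₂ n (λ a b → ι a b * f a b) ∎
  where open ≡-Reasoning

Triple : ℕ → Set
Triple n = Fin n × Fin n × Fin n

triples : ∀ n → List (Triple n)
triples n = cartesianProduct (allFin n) (cartesianProduct (allFin n) (allFin n))

triples-unique : ∀ n → Unique (triples n)
triples-unique n = Unique.cartesianProduct⁺ (Unique.allFin⁺ n)
                     (Unique.cartesianProduct⁺ (Unique.allFin⁺ n) (Unique.allFin⁺ n))

Σ-triples : ∀ n (f : Fin n → Fin n → Fin n → ℕ) →
  Σˡ (triples n) (λ τ → f (proj₁ τ) (proj₁ (proj₂ τ)) (proj₂ (proj₂ τ))) ≡ Σ₃ n f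
Σ-triples n f = begin
  Σˡ (triples n) (λ τ → f (proj₁ τ) (proj₁ (proj₂ τ)) (proj₂ (proj₂ τ)))
    ≡⟨ Σˡ-cartesian (allFin n) (cartesianProduct (allFin n) (allFin n)) _ ⟩
  Σˡ (allFin n) (λ i → Σˡ (cartesianProduct (allFin n) (allFin n)) (λ e → f i (proj₁ e) (proj₂ e)))
    ≡⟨ Σˡ-cong (allFin n) (λ i → Σˡ-cartesian (allFin n) (allFin n) (λ e → f i (proj₁ e) (proj₂ e))) ⟩
  Σˡ (allFin n) (λ i → Σˡ (allFin n) (λ j → Σˡ (allFin n) (λ k → f i j k)))
    ≡⟨ trans (Σˡ-allFin n _) (sum-cong-≗ (λ i → trans (Σˡ-allFin n _)
         (sum-cong-≗ (λ j → Σˡ-allFin n (f i j))))) ⟩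
  Σ₃ n f ∎
  where open ≡-Reasoning

Colouring : ℕ → Set
Colouring n = Fin n → Fin n → Fin 3

recolour : ∀ {n} → Colouring n → Fin n → Fin n → Fin 3 → Colouring n
recolour c i j x i′ j′ with i′ ≟ i | j′ ≟ j
... | yes _ | yes _ = x
... | _     | _     = c i′ j′

recolour-here : ∀ {n} (c : Colouring n) i j x → recolour c i j x i j ≡ x
recolour-here c i j x with i ≟ i | j ≟ j
... | yes _ | yes _ = refl
... | no i≢i | _ = ⊥-elim (i≢i refl)
... | yes _ | no j≢j = ⊥-elim (j≢j refl)

recolour-elsewhere : ∀ {n} (c : Colouring n) {i j i′ j′} x →
  ¬ (i′ ≡ i × j′ ≡ j) → recolour c i j x i′ j′ ≡ c i′ j′
recolour-elsewhere c {i} {j} {i′} {j′} x elsewhere with i′ ≟ i | j′ ≟ j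
... | yes i′≡i | yes j′≡j = ⊥-elim (elsewhere (i′≡i , j′≡j))
... | yes _ | no _ = refl
... | no _ | _ = refl

indicator-*-mono : ∀ c {x y} → c ≤ 1 → (c ≡ 1 → x ≤ y) → c * x ≤ c * y
indicator-*-mono zero _ _ = z≤n
indicator-*-mono (suc zero) _ x≤y = *-monoʳ-≤ 1 (x≤y refl)
indicator-*-mono (suc (suc _)) (s≤s ()) _

ι-*-≤ : ∀ {n} (a b : Fin n) {x y} → (a <ᶠ b → x ≤ y) → ι a b * x ≤ y
ι-*-≤ a b {x} x≤y with ι-split a b
... | inj₁ a<b rewrite ι-< a<b = ≤-trans (≤-reflexive (*-identityˡ x)) (x≤y a<b)
... | inj₂ ι≡0 rewrite ι≡0 = z≤n

2^-reflects-≤ : ∀ m n → 2 ^ m ≤ 2 ^ n → m ≤ n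
2^-reflects-≤ m n 2^m≤2^n with m ≤? n
... | yes m≤n = m≤n
... | no m≰n = ⊥-elim (<⇒≱ (^-monoʳ-< 2 (s≤s (s≤s z≤n)) (≰⇒> m≰n)) 2^m≤2^n)

-- The arithmetic combining the counting inequality (n - 2)Φ + I ≤ 3T + 4B with
-- 3T = (n - 2)N, the entropy bound qN ≤ qΦ + 2pN and the rainbow bound qB ≤ pT:
-- multiplying the first by q and inserting the others leaves qI ≤ 10pT.
counting-arithmetic : ∀ m Φ I T B N q p →
  m * Φ + I ≤ 3 * T + 4 * B → 3 * T ≡ m * N → q * N ≤ Φ * q + 2 * (p * N) → B * q ≤ p * T →
  q * I ≤ 10 * p * T
counting-arithmetic m Φ I T B N q p counting three entropy rainbow =
  +-cancelˡ-≤ (3 * q * T) _ _ (begin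
    3 * q * T + q * I                       ≡⟨ cong (_+ q * I) (trans (r₁ q T) (cong (q *_) three)) ⟩
    q * (m * N) + q * I                     ≡⟨ cong (_+ q * I) (r₂ q m N) ⟩
    m * (q * N) + q * I                     ≤⟨ +-monoˡ-≤ (q * I) (*-monoʳ-≤ m entropy) ⟩
    m * (Φ * q + 2 * (p * N)) + q * I       ≡⟨ r₃ m Φ q p N I ⟩
    q * (m * Φ + I) + 2 * p * (m * N)       ≡⟨ cong (λ x → q * (m * Φ + I) + 2 * p * x) (sym three) ⟩
    q * (m * Φ + I) + 2 * p * (3 * T)       ≤⟨ +-monoˡ-≤ _ (*-monoʳ-≤ q counting) ⟩
    q * (3 * T + 4 * B) + 2 * p * (3 * T)   ≡⟨ r₄ q T B p ⟩
    3 * q * T + 4 * (B * q) + 6 * p * T     ≤⟨ +-monoˡ-≤ _ (+-monoʳ-≤ (3 * q * T) (*-monoʳ-≤ 4 rainbow)) ⟩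
    3 * q * T + 4 * (p * T) + 6 * p * T     ≡⟨ r₅ q T p ⟩
    3 * q * T + 10 * p * T                  ∎)
  where
  open ≤-Reasoning
  r₁ : ∀ q T → 3 * q * T ≡ q * (3 * T)
  r₁ = solve-∀
  r₂ : ∀ q m N → q * (m * N) ≡ m * (q * N)
  r₂ = solve-∀
  r₃ : ∀ m Φ q p N I → m * (Φ * q + 2 * (p * N)) + q * I ≡ q * (m * Φ + I) + 2 * p * (m * N)
  r₃ = solve-∀
  r₄ : ∀ q T B p → q * (3 * T + 4 * B) + 2 * p * (3 * T) ≡ 3 * q * T + 4 * (B * q) + 6 * p * T
  r₄ = solve-∀
  r₅ : ∀ q T p → 3 * q * T + 4 * (p * T) + 6 * p * T ≡ 3 * q * T + 10 * p * T
  r₅ = solve-∀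

scaled-total-cost : ∀ n N T I b → 3 * T ≡ (n ∸ 2) * N → 6 * b * I ≤ T →
  2 * b * (3 * n * (6 * I)) ≤ 2 * N * (n * (n ∸ 2))
scaled-total-cost n N T I b three few = begin
  2 * b * (3 * n * (6 * I))   ≡⟨ regroup b n I ⟩
  6 * n * (6 * b * I)         ≤⟨ *-monoʳ-≤ (6 * n) few ⟩
  6 * n * T                   ≡⟨ regroup′ n T ⟩
  2 * n * (3 * T)             ≡⟨ cong (2 * n *_) three ⟩
  2 * n * ((n ∸ 2) * N)       ≡⟨ regroup″ n (n ∸ 2) N ⟩
  2 * N * (n * (n ∸ 2))       ∎
  where
  open ≤-Reasoning
  regroup : ∀ b n I → 2 * b * (3 * n * (6 * I)) ≡ 6 * n * (6 * b * I)
  regroup = solve-∀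
  regroup′ : ∀ n T → 6 * n * T ≡ 2 * n * (3 * T)
  regroup′ = solve-∀
  regroup″ : ∀ n m N → 2 * n * (m * N) ≡ 2 * N * (n * m)
  regroup″ = solve-∀

cheap-and-expensive : ∀ K c b → 0 < K → 0 < b → K ≤ c → 2 * b * c ≤ K → ⊥
cheap-and-expensive K c b 0<K 0<b K≤c cheap = <⇒≱ (begin-strict
  K              <⟨ m<m+n K 0<K ⟩
  K + K          ≤⟨ +-mono-≤ K≤c (≤-trans K≤c (m≤m+n c 0)) ⟩
  2 * c          ≤⟨ *-monoʳ-≤ 2 (m≤m*n c b {{>-nonZero 0<b}}) ⟩
  2 * (c * b)    ≡⟨ regroup c b ⟩
  2 * b * c      ∎) cheap
  where
  open ≤-Reasoning
  regroup : ∀ c b → 2 * (c * b) ≡ 2 * b * c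
  regroup = solve-∀

few-from-cheap : ∀ bad c b K N a → 0 < a → bad ≤ c → 2 * b * c ≤ K → K ≤ 2 * N → bad * b ≤ a * N
few-from-cheap bad c b K N a 0<a bad≤c cheap K≤2N = *-cancelˡ-≤ 2 (begin
  2 * (bad * b)    ≡⟨ regroup bad b ⟩
  2 * b * bad      ≤⟨ *-monoʳ-≤ (2 * b) bad≤c ⟩
  2 * b * c        ≤⟨ cheap ⟩
  K                ≤⟨ K≤2N ⟩
  2 * N            ≤⟨ *-monoʳ-≤ 2 (m≤n*m N a {{>-nonZero 0<a}}) ⟩
  2 * (a * N)      ∎)
  where
  open ≤-Reasoning
  regroup : ∀ bad b → 2 * (bad * b) ≡ 2 * b * bad
  regroup = solve-∀

module _ {n : ℕ} (t : Template n) where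

  S : Fin n → Fin n → Colours
  S a b with a <ᶠ? b
  ... | yes _ = col t a b
  ... | no _ = col t b a

  S-< : ∀ {a b} → a <ᶠ b → S a b ≡ col t a b
  S-< {a} {b} a<b with a <ᶠ? b
  ... | yes _ = refl
  ... | no a≮b = ⊥-elim (a≮b a<b)

  S-≮ : ∀ {a b} → ¬ a <ᶠ b → S a b ≡ col t b a
  S-≮ {a} {b} a≮b with a <ᶠ? b
  ... | yes a<b = ⊥-elim (a≮b a<b)
  ... | no _ = refl

  S-sym : ∀ a b → S a b ≡ S b a
  S-sym a b with FinP.<-cmp a b
  ... | tri< a<b _ b≮a = trans (S-< a<b) (sym (S-≮ b≮a))
  ... | tri≈ _ refl _ = refl
  ... | tri> a≮b _ b<a = trans (S-≮ a≮b) (sym (S-< b<a))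

  Realises : Colouring n → Set
  Realises c = ∀ i j → i <ᶠ j → c i j ∈ col t i j

  some-colouring : Colouring n
  some-colouring i j with i <ᶠ? j
  ... | yes i<j = proj₁ (nonempty t i j i<j)
  ... | no _ = zero

  some-colouring-realises : Realises some-colouring
  some-colouring-realises i j i<j with i <ᶠ? j
  ... | yes i<j′ = proj₂ (nonempty t i j i<j′)
  ... | no i≮j = ⊥-elim (i≮j i<j)

  recolour-realises : ∀ {c i j x} → Realises c → x ∈ col t i j → Realises (recolour c i j x)
  recolour-realises {c} {i} {j} {x} c-realises x∈ i′ j′ i′<j′ with i′ ≟ i | j′ ≟ j
  ... | yes refl | yes refl = x∈
  ... | yes _ | no _ = c-realises i′ j′ i′<j′
  ... | no _ | _ = c-realises i′ j′ i′<j′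

  -- An SDR of the colour sets of a triangle i < j < k makes it rainbow in the
  -- realisation obtained by recolouring its three edges.
  rainbow-from-SDR : ∀ {i j k} → i <ᶠ j → j <ᶠ k → SDR (col t i j) (col t j k) (col t i k) →
    RainbowInSomeRealisation t (i , j , k)
  rainbow-from-SDR {i} {j} {k} i<j j<k (x , y , z , (x∈ , y∈ , z∈) , (x≢y , y≢z , x≢z)) =
    i<j , j<k , (c , realises) ,
    (λ e → x≢y (trans (sym c-ij) (trans e c-jk))) ,
    (λ e → x≢z (trans (sym c-ij) (trans e c-ik))) ,
    (λ e → y≢z (trans (sym c-jk) (trans e c-ik)))
    where
    c₁ c₂ c : Colouring n
    c₁ = recolour some-colouring i j x
    c₂ = recolour c₁ j k y
    c = recolour c₂ i k z
    realises : Realises c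
    realises = recolour-realises (recolour-realises (recolour-realises some-colouring-realises x∈) y∈) z∈
    c-ik : c i k ≡ z
    c-ik = recolour-here c₂ i k z
    c-jk : c j k ≡ y
    c-jk = trans (recolour-elsewhere c₂ {i} {k} {j} {k} z (λ e → FinP.<⇒≢ i<j (sym (proj₁ e))))
                 (recolour-here c₁ j k y)
    c-ij : c i j ≡ x
    c-ij = trans (recolour-elsewhere c₂ {i} {k} {i} {j} z (λ e → FinP.<⇒≢ j<k (proj₂ e)))
          (trans (recolour-elsewhere c₁ {j} {k} {i} {j} y (λ e → FinP.<⇒≢ i<j (proj₁ e)))
                 (recolour-here some-colouring i j x))

  Candidate : Triple n → Set
  Candidate (i , j , k) = i <ᶠ j × j <ᶠ k × SDR (S i j) (S j k) (S i k)

  candidate? : (τ : Triple n) → Dec (Candidate τ)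
  candidate? (i , j , k) = i <ᶠ? j ×-dec j <ᶠ? k ×-dec sdr? (S i j) (S j k) (S i k)

  candidate-rainbow : ∀ τ → Candidate τ → RainbowInSomeRealisation t τ
  candidate-rainbow (i , j , k) (i<j , j<k , sdr) = rainbow-from-SDR i<j j<k
    (subst₂ (λ X Y → SDR X Y (col t i k)) (S-< i<j) (S-< j<k)
      (subst (SDR (S i j) (S j k)) (S-< (FinP.<-trans i<j j<k)) sdr))

  rainbowable : ℕ
  rainbowable = Σ₃ n (λ i j k → ι₃ i j k * 𝟙 (does (sdr? (S i j) (S j k) (S i k))))

  candidates : List (Triple n)
  candidates = filter candidate? (triples n)

  candidates-length : length candidates ≡ rainbowable
  candidates-length = begin
    length candidates                                        ≡⟨ length-Σˡ candidates ⟩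
    Σˡ candidates (λ _ → 1)                                  ≡⟨ Σˡ-filter candidate? (triples n) (λ _ → 1) ⟩
    Σˡ (triples n) (λ τ → 𝟙 (does (candidate? τ)) * 1)
      ≡⟨ Σ-triples n (λ i j k → 𝟙 (does (candidate? (i , j , k))) * 1) ⟩
    Σ₃ n (λ i j k → 𝟙 (does (candidate? (i , j , k))) * 1)
      ≡⟨ Σ₃-cong (λ i j k → 𝟙-∧₃ (does (i <ᶠ? j)) (does (j <ᶠ? k))
                                 (does (sdr? (S i j) (S j k) (S i k)))) ⟩
    rainbowable                                              ∎
    where open ≡-Reasoning

  rainbowable-bound : ∀ {p q} → FewRainbowCond t p q → rainbowable * q ≤ p * (n C 3)
  rainbowable-bound {p} {q} few = subst (λ L → L * q ≤ p * (n C 3)) candidates-length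
    (few candidates (Unique.filter⁺ candidate? (triples-unique n))
                    (All.map (λ {τ} → candidate-rainbow τ) (all-filter candidate? (triples n))))

  Φ : ℕ
  Φ = Σ₂ n (λ a b → ι a b * φ (S a b))

  expEnt≤2^Φ : expEnt t ≤ 2 ^ Φ
  expEnt≤2^Φ = ≤-trans
    (product≤2^Σ (edges n) _ (λ e → φ (col t (proj₁ e) (proj₂ e)))
                             (λ e → size≤2^φ (col t (proj₁ e) (proj₂ e))))
    (≤-reflexive (cong (2 ^_) (trans (Σ-edges n (λ a b → φ (col t a b))) (Σ₂-cong on-edges))))
    where
    on-edges : ∀ a b → ι a b * φ (col t a b) ≡ ι a b * φ (S a b)
    on-edges a b with ι-split a b
    ... | inj₁ a<b = cong (λ X → ι a b * φ X) (sym (S-< a<b))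
    ... | inj₂ ι≡0 rewrite ι≡0 = refl

  -- Condition (i), after bounding 3 ≤ 2 ^ 2: (n choose 2) ≤ Φ + 2δ (n choose 2).
  entropy-bound : ∀ {p q} → EntropyCond t p q → q * (n C 2) ≤ Φ * q + 2 * (p * (n C 2))
  entropy-bound {p} {q} entropy = 2^-reflects-≤ _ _ (begin
    2 ^ (q * N)                          ≤⟨ entropy ⟩
    expEnt t ^ q * 3 ^ (p * N)           ≤⟨ *-mono-≤ (^-monoˡ-≤ q expEnt≤2^Φ) (^-monoˡ-≤ (p * N) 3≤4) ⟩
    (2 ^ Φ) ^ q * 4 ^ (p * N)            ≡⟨ cong₂ _*_ (^-*-assoc 2 Φ q) (^-*-assoc 2 2 (p * N)) ⟩
    2 ^ (Φ * q) * 2 ^ (2 * (p * N))      ≡⟨ sym (^-distribˡ-+-* 2 (Φ * q) _) ⟩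
    2 ^ (Φ * q + 2 * (p * N))            ∎)
    where
    open ≤-Reasoning
    N : ℕ
    N = n C 2
    3≤4 : 3 ≤ 4
    3≤4 = n≤1+n 3

  imperfectᵗ : Fin n → Fin n → Fin n → ℕ
  imperfectᵗ a b c = imperfect (S a b) (S b c) (S a c)

  imperfect-triangles : ℕ
  imperfect-triangles = Σ₃ n (λ i j k → ι₃ i j k * imperfectᵗ i j k)

  S-nonempty : ∀ {a b} → a <ᶠ b → Nonempty (S a b)
  S-nonempty {a} {b} a<b = subst Nonempty (sym (S-< a<b)) (nonempty t a b a<b)

  -- The local bound summed over all triangles; each edge lies in n - 2 of them.
  triangle-bound : (n ∸ 2) * Φ + imperfect-triangles ≤ 3 * (n C 3) + 4 * rainbowable
  triangle-bound = begin
    (n ∸ 2) * Φ + imperfect-triangles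
      ≡⟨ cong (_+ imperfect-triangles) (sym (triangle-edge-sum (λ a b → φ (S a b)))) ⟩
    Σ₃ n (λ i j k → ι₃ i j k * weight i j k) + imperfect-triangles
      ≡⟨ sym (Σ₃-+ (λ i j k → ι₃ i j k * weight i j k) (λ i j k → ι₃ i j k * imperfectᵗ i j k)) ⟩
    Σ₃ n (λ i j k → ι₃ i j k * weight i j k + ι₃ i j k * imperfectᵗ i j k)
      ≡⟨ Σ₃-cong (λ i j k → sym (*-distribˡ-+ (ι₃ i j k) (weight i j k) (imperfectᵗ i j k))) ⟩
    Σ₃ n (λ i j k → ι₃ i j k * (weight i j k + imperfectᵗ i j k))
      ≤⟨ Σ₃-mono (λ i j k → indicator-*-mono (ι₃ i j k) (ι₃≤1 i j k) (local i j k)) ⟩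
    Σ₃ n (λ i j k → ι₃ i j k * (3 + 4 * sdr i j k))
      ≡⟨ Σ₃-cong (λ i j k → expand (ι₃ i j k) (sdr i j k)) ⟩
    Σ₃ n (λ i j k → 3 * ι₃ i j k + 4 * (ι₃ i j k * sdr i j k))
      ≡⟨ Σ₃-+ (λ i j k → 3 * ι₃ i j k) (λ i j k → 4 * (ι₃ i j k * sdr i j k)) ⟩
    Σ₃ n (λ i j k → 3 * ι₃ i j k) + Σ₃ n (λ i j k → 4 * (ι₃ i j k * sdr i j k))
      ≡⟨ cong₂ _+_ (trans (Σ₃-*ˡ {n} 3 ι₃) (cong (3 *_) (triangles-count n)))
                   (Σ₃-*ˡ 4 (λ i j k → ι₃ i j k * sdr i j k)) ⟩
    3 * (n C 3) + 4 * rainbowable ∎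
    where
    open ≤-Reasoning
    weight sdr : Fin n → Fin n → Fin n → ℕ
    weight i j k = φ (S i j) + φ (S j k) + φ (S i k)
    sdr i j k = 𝟙 (does (sdr? (S i j) (S j k) (S i k)))
    local : ∀ i j k → ι₃ i j k ≡ 1 → weight i j k + imperfectᵗ i j k ≤ 3 + 4 * sdr i j k
    local i j k ι₃≡1 with ι₃≡1⇒increasing {i = i} {j} {k} ι₃≡1
    ... | i<j , j<k = local-bound (S i j) (S j k) (S i k)
                        (S-nonempty i<j) (S-nonempty j<k) (S-nonempty (FinP.<-trans i<j j<k))
    expand : ∀ c s → c * (3 + 4 * s) ≡ 3 * c + 4 * (c * s)
    expand = solve-∀

  few-imperfect : ∀ {p q} → EntropyCond t p q → FewRainbowCond t p q →
    q * imperfect-triangles ≤ 10 * p * (n C 3)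
  few-imperfect {p} {q} entropy few =
    counting-arithmetic (n ∸ 2) Φ imperfect-triangles (n C 3) rainbowable (n C 2) q p
      triangle-bound (three-triangles n) (entropy-bound {p} {q} entropy) (rainbowable-bound {p} {q} few)

  -- The imperfection of the ordered triple (a , b , c); distinct triples count
  -- once for each of their six orders, degenerate ones not at all.
  imperfect₃ : Fin n → Fin n → Fin n → ℕ
  imperfect₃ a b c = orderings a b c * imperfectᵗ a b c

  imperfect₃-total : Σ₃ n imperfect₃ ≡ 6 * imperfect-triangles
  imperfect₃-total = symmetrise imperfectᵗ swap₁₂ swap₂₃
    where
    swap₁₂ : ∀ a b c → imperfectᵗ b a c ≡ imperfectᵗ a b c
    swap₁₂ a b c = trans (cong (λ X → imperfect X (S a c) (S b c)) (S-sym b a))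
                         (imperfect-swap₂₃ (S a b) (S b c) (S a c))
    swap₂₃ : ∀ a b c → imperfectᵗ a c b ≡ imperfectᵗ a b c
    swap₂₃ a b c = trans (cong (λ Y → imperfect (S a c) Y (S a b)) (S-sym c b))
                         (imperfect-reverse (S a b) (S b c) (S a c))

  perfect-triangle : ∀ {a b c} → a ≢ b → b ≢ c → a ≢ c → imperfect₃ a b c ≡ 0 →
    S a b ≡ S b c × S a b ≡ S a c
  perfect-triangle {a} {b} {c} a≢b b≢c a≢c none = ab≡bc , trans ab≡bc bc≡ac
    where
    imperfect≡0 : imperfectᵗ a b c ≡ 0
    imperfect≡0 = trans (sym (*-identityˡ _))
                        (subst (λ o → o * imperfectᵗ a b c ≡ 0) (orderings-distinct a b c a≢b b≢c a≢c) none)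
    perfect : Perfect (S a b) (S b c) (S a c)
    perfect = 𝟙-fails-0 (perfect? (S a b) (S b c) (S a c)) imperfect≡0
    ab≡bc : S a b ≡ S b c
    ab≡bc = proj₁ perfect
    bc≡ac : S b c ≡ S a c
    bc≡ac = proj₁ (proj₂ perfect)

  through-pair : ∀ {v u w} → v ≢ u → w ≢ v → w ≢ u → imperfect₃ v u w ≡ 0 →
    S v w ≡ S v u × S u w ≡ S v u
  through-pair v≢u w≢v w≢u none with perfect-triangle v≢u (≢-sym w≢u) (≢-sym w≢v) none
  ... | vu≡uw , vu≡vw = sym vu≡vw , sym vu≡uw

  edge-agrees : ∀ {v u a b} → v ≢ u → a <ᶠ b →
    imperfect₃ v u a ≡ 0 → imperfect₃ v a b ≡ 0 → imperfect₃ v u b ≡ 0 → S a b ≡ S v u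
  edge-agrees {v} {u} {a} {b} v≢u a<b vua vab vub with a ≟ v | a ≟ u | b ≟ v | b ≟ u
  ... | yes refl | _ | _ | yes refl = refl
  ... | yes refl | _ | yes b≡a | _ = ⊥-elim (FinP.<⇒≢ a<b (sym b≡a))
  ... | yes refl | _ | no b≢v | no b≢u = proj₁ (through-pair v≢u b≢v b≢u vub)
  ... | no _ | yes refl | yes refl | _ = S-sym u v
  ... | no _ | yes refl | _ | yes b≡a = ⊥-elim (FinP.<⇒≢ a<b (sym b≡a))
  ... | no _ | yes refl | no b≢v | no b≢u = proj₂ (through-pair v≢u b≢v b≢u vub)
  ... | no a≢v | no a≢u | yes refl | _ = trans (S-sym a v) (proj₁ (through-pair v≢u a≢v a≢u vua))
  ... | no a≢v | no a≢u | no _ | yes refl = trans (S-sym a u) (proj₂ (through-pair v≢u a≢v a≢u vua))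
  ... | no a≢v | no a≢u | no b≢v | no b≢u =
    trans (sym (proj₁ (perfect-triangle (≢-sym a≢v) (FinP.<⇒≢ a<b) (≢-sym b≢v) vab)))
          (proj₁ (through-pair v≢u a≢v a≢u vua))

  differs≤witnesses : ∀ {v u a b} → v ≢ u → a <ᶠ b →
    𝟙 (does (¬? (col t a b ≟ᶜ S v u))) ≤ imperfect₃ v u a + imperfect₃ v a b + imperfect₃ v u b
  differs≤witnesses {v} {u} {a} {b} v≢u a<b with col t a b ≟ᶜ S v u
  ... | yes _ = z≤n
  ... | no differs = n≢0⇒n>0 (λ none → differs (trans (sym (S-< a<b)) (agrees none)))
    where
    agrees : imperfect₃ v u a + imperfect₃ v a b + imperfect₃ v u b ≡ 0 → S a b ≡ S v u
    agrees none = edge-agrees v≢u a<b (m+n≡0⇒m≡0 _ vua+vab≡0) (m+n≡0⇒n≡0 _ vua+vab≡0) (m+n≡0⇒n≡0 _ none)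
      where
      vua+vab≡0 : imperfect₃ v u a + imperfect₃ v a b ≡ 0
      vua+vab≡0 = m+n≡0⇒m≡0 _ none

  -- The cost of the pair (v , u): the witnesses of the edges disagreeing with S v u.
  cost : Fin n → Fin n → ℕ
  cost v u = Σ₂ n (λ a b → imperfect₃ v u a + imperfect₃ v a b + imperfect₃ v u b)

  badEdges≤cost : ∀ {v u} → v ≢ u → badEdges t (S v u) ≤ cost v u
  badEdges≤cost {v} {u} v≢u = begin
    badEdges t (S v u)
      ≡⟨ length-Σˡ (filter differs? (edges n)) ⟩
    Σˡ (filter differs? (edges n)) (λ _ → 1)
      ≡⟨ Σˡ-filter differs? (edges n) (λ _ → 1) ⟩
    Σˡ (edges n) (λ e → 𝟙 (does (differs? e)) * 1)
      ≡⟨ Σ-edges n (λ a b → 𝟙 (does (¬? (col t a b ≟ᶜ S v u))) * 1) ⟩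
    Σ₂ n (λ a b → ι a b * (𝟙 (does (¬? (col t a b ≟ᶜ S v u))) * 1))
      ≤⟨ Σ₂-mono (λ a b → ι-*-≤ a b (λ a<b →
           ≤-trans (≤-reflexive (*-identityʳ _)) (differs≤witnesses v≢u a<b))) ⟩
    cost v u ∎
    where
    open ≤-Reasoning
    differs? : (e : Fin n × Fin n) → Dec (¬ col t (proj₁ e) (proj₂ e) ≡ S v u)
    differs? e = ¬? (col t (proj₁ e) (proj₂ e) ≟ᶜ S v u)

  -- Each imperfect ordered triple is charged n times by each of the three
  -- positions in the cost, summed over all pairs.
  total-cost : Σ₂ n cost ≡ 3 * n * Σ₃ n imperfect₃
  total-cost = begin
    Σ₂ n cost
      ≡⟨ Σ₂-cong (λ v u → Σ₂-+₃ (λ a b → imperfect₃ v u a) (imperfect₃ v) (λ a b → imperfect₃ v u b)) ⟩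
    Σ₂ n (λ v u → Σ₂ n (λ a b → imperfect₃ v u a) + Σ₂ n (imperfect₃ v)
                  + Σ₂ n (λ a b → imperfect₃ v u b))
      ≡⟨ Σ₂-+₃ (λ v u → Σ₂ n (λ a b → imperfect₃ v u a)) (λ v u → Σ₂ n (imperfect₃ v))
               (λ v u → Σ₂ n (λ a b → imperfect₃ v u b)) ⟩
    Σ₂ n (λ v u → Σ₂ n (λ a b → imperfect₃ v u a)) + Σ₂ n (λ v u → Σ₂ n (imperfect₃ v))
      + Σ₂ n (λ v u → Σ₂ n (λ a b → imperfect₃ v u b))
      ≡⟨ cong₂ _+_ (cong₂ _+_ unused-b unused-u) unused-a ⟩
    n * H + n * H + n * H
      ≡⟨ thrice n H ⟩
    3 * n * H ∎
    where
    open ≡-Reasoning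
    H : ℕ
    H = Σ₃ n imperfect₃
    unused-b : Σ₂ n (λ v u → Σ₂ n (λ a b → imperfect₃ v u a)) ≡ n * H
    unused-b = trans (Σ₂-cong (λ v u → sum-cong-≗ (λ a → Σ-const n (imperfect₃ v u a))))
                     (Σ₃-*ˡ n imperfect₃)
    unused-u : Σ₂ n (λ v u → Σ₂ n (imperfect₃ v)) ≡ n * H
    unused-u = trans (sum-cong-≗ (λ v → Σ-const n (Σ₂ n (imperfect₃ v))))
                     (Σ-*ˡ n (λ v → Σ₂ n (imperfect₃ v)))
    unused-a : Σ₂ n (λ v u → Σ₂ n (λ a b → imperfect₃ v u b)) ≡ n * H
    unused-a = trans (Σ₂-cong (λ v u → Σ-const n (sum (imperfect₃ v u))))
                     (Σ₂-*ˡ n (λ v u → sum (imperfect₃ v u)))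
    thrice : ∀ n H → n * H + n * H + n * H ≡ 3 * n * H
    thrice = solve-∀

  -- If S v u is not a pair of colours, no triangle through v and u is perfect,
  -- so each of the n - 2 third vertices is charged n times.
  cost-lower : ∀ {v u} → v ≢ u → ∣ S v u ∣ ≢ 2 → n * (n ∸ 2) ≤ cost v u
  cost-lower {v} {u} v≢u not-pair = begin
    n * (n ∸ 2)                                  ≤⟨ *-monoʳ-≤ n third-vertex-count ⟩
    n * ∑[ c < n ] imperfect₃ v u c               ≡⟨ sym (Σ-*ˡ n (imperfect₃ v u)) ⟩
    ∑[ c < n ] (n * imperfect₃ v u c)             ≡⟨ sum-cong-≗ (λ c → sym (Σ-const n (imperfect₃ v u c))) ⟩
    Σ₂ n (λ a b → imperfect₃ v u a)               ≤⟨ Σ₂-mono (λ a b → first-of-three (imperfect₃ v u a) _ _) ⟩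
    cost v u                                     ∎
    where
    open ≤-Reasoning
    first-of-three : ∀ x y z → x ≤ x + y + z
    first-of-three x y z = ≤-trans (m≤m+n x y) (m≤m+n (x + y) z)
    imperfect≡1 : ∀ c → imperfectᵗ v u c ≡ 1
    imperfect≡1 c = 𝟙-fails-1 (perfect? (S v u) (S u c) (S v c)) (λ perfect → not-pair (proj₂ (proj₂ perfect)))
    counted : ∀ c → orderings v u c ≤ imperfect₃ v u c
    counted c = ≤-reflexive (trans (sym (*-identityʳ _)) (cong (orderings v u c *_) (sym (imperfect≡1 c))))
    third-vertex-count : n ∸ 2 ≤ ∑[ c < n ] imperfect₃ v u c
    third-vertex-count with FinP.<-cmp v u
    ... | tri< v<u _ _ = ≤-trans (≤-reflexive (sym (outside-sum v<u)))
                           (Σ-mono (λ c → ≤-trans (outside≤orderings v u c v<u) (counted c)))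
    ... | tri≈ _ v≡u _ = ⊥-elim (v≢u v≡u)
    ... | tri> _ _ u<v = ≤-trans (≤-reflexive (sym (outside-sum u<v)))
                           (Σ-mono (λ c → ≤-trans (outside≤orderings u v c u<v)
                             (≤-trans (≤-reflexive (orderings-swap₁₂ v u c)) (counted c))))

  -- If few triangles are imperfect, some pair of distinct vertices is cheap,
  -- 2b · cost ≤ n(n - 2): otherwise averaging the cost over the 2 (n choose 2)
  -- ordered pairs would exceed its total.
  cheap-pair : ∀ {b} → 3 ≤ n → 6 * b * imperfect-triangles ≤ n C 3 →
    ∃ λ v → ∃ λ u → v ≢ u × 2 * b * cost v u ≤ n * (n ∸ 2)
  cheap-pair {b} 3≤n few
    with FinP.any? (λ v → FinP.any? (λ u → ¬? (v ≟ u) ×-dec (2 * b * cost v u ≤? n * (n ∸ 2))))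
  ... | yes cheap = cheap
  ... | no none = ⊥-elim (1+n≰n (*-cancelˡ-≤ (2 * N) {{>-nonZero 0<2N}} (begin
    2 * N * suc K                                ≤⟨ averaging (λ v u → 2 * b * cost v u) K all-expensive ⟩
    Σ₂ n (λ v u → 2 * b * cost v u)              ≡⟨ Σ₂-*ˡ (2 * b) cost ⟩
    2 * b * Σ₂ n cost                            ≡⟨ cong (2 * b *_) (trans total-cost
                                                      (cong (3 * n *_) imperfect₃-total)) ⟩
    2 * b * (3 * n * (6 * imperfect-triangles))  ≤⟨ scaled-total-cost n N (n C 3) imperfect-triangles b
                                                      (three-triangles n) few ⟩
    2 * N * K                                    ∎)))
    where
    open ≤-Reasoning
    N K : ℕ
    N = n C 2
    K = n * (n ∸ 2)
    all-expensive : ∀ v u → v ≢ u → K < 2 * b * cost v u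
    all-expensive v u v≢u = ≰⇒> (λ cheap → none (v , u , v≢u , cheap))
    0<2N : 0 < 2 * N
    0<2N = ≤-trans (s≤s z≤n) (*-monoʳ-≤ 2 (pairs-positive n (≤-trans (n≤1+n 2) 3≤n)))

  -- Stability: the cheap pair (v , u) must carry a pair of colours {c₁ , c₂}
  -- (otherwise it would be expensive), and then all but at most (n choose 2)/b
  -- edges carry exactly that pair.
  stability : ∀ {a b} → 0 < a → 0 < b → 3 ≤ n → 6 * b * imperfect-triangles ≤ n C 3 →
    ∃ λ c₁ → ∃ λ c₂ → c₁ ≢ c₂ × badEdges t (⁅ c₁ ⁆ ∪ ⁅ c₂ ⁆) * b ≤ a * (n C 2)
  stability {a} {b} 0<a 0<b 3≤n few with cheap-pair {b} 3≤n few
  ... | v , u , v≢u , cheap with ∣ S v u ∣ ≟ℕ 2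
  ...   | no not-pair =
    ⊥-elim (cheap-and-expensive (n * (n ∸ 2)) (cost v u) b 0<n[n-2] 0<b (cost-lower v≢u not-pair) cheap)
    where
    0<n[n-2] : 0 < n * (n ∸ 2)
    0<n[n-2] = *-mono-≤ (≤-trans (s≤s z≤n) 3≤n) (∸-monoˡ-≤ 2 3≤n)
  ...   | yes pair with size-two (S v u) pair
  ...     | c₁ , c₂ , c₁≢c₂ , S≡c₁c₂ = c₁ , c₂ , c₁≢c₂ ,
    subst (λ X → badEdges t X * b ≤ a * (n C 2)) S≡c₁c₂
      (few-from-cheap (badEdges t (S v u)) (cost v u) b (n * (n ∸ 2)) (n C 2) a
        0<a (badEdges≤cost v≢u) cheap (n[n∸2]≤2[nC2] n))

theorem4p16 : (a b : ℕ) → 0 < a → 0 < b →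
    ∃ λ (p : ℕ) → ∃ λ (q : ℕ) → 0 < p × 0 < q × ∃ λ (n₀ : ℕ) →
      (n : ℕ) → n₀ ≤ n → (t : Template n) →
      EntropyCond t p q → FewRainbowCond t p q →
      ∃ λ (c₁ : Fin 3) → ∃ λ (c₂ : Fin 3) → ¬ (c₁ ≡ c₂) ×
        badEdges t (⁅ c₁ ⁆ ∪ ⁅ c₂ ⁆) * b ≤ a * (n C 2)
theorem4p16 a b 0<a 0<b = 1 , 60 * b , s≤s z≤n , 0<60b , 3 , λ n 3≤n t entropy few →
  stability t 0<a 0<b 3≤n (*-cancelˡ-≤ 10 (begin
    10 * (6 * b * imperfect-triangles t)   ≡⟨ regroup b (imperfect-triangles t) ⟩
    60 * b * imperfect-triangles t         ≤⟨ few-imperfect t {1} {60 * b} entropy few ⟩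
    10 * 1 * (n C 3)                       ≡⟨ cong (_* (n C 3)) (*-identityʳ 10) ⟩
    10 * (n C 3)                           ∎))
  where
  open ≤-Reasoning
  0<60b : 0 < 60 * b
  0<60b = ≤-trans (s≤s z≤n) (*-monoʳ-≤ 60 0<b)
  regroup : ∀ b I → 10 * (6 * b * I) ≡ 60 * b * I
  regroup = solve-∀
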